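{- For every integer $n \geq 4$, $$\nabla(C_{n}^{2}) = \begin{cases} \left\lceil \frac{n+1}{3} \right\rceil & \text{if } n \not\equiv 2 \pmod 3,\\[4pt] \left\lceil \frac{n+1}{3} \right\rceil + 1 & \text{if } n \equiv 2 \pmod 3. \end{cases}$$
   Context: For a simple graph $G$, a set $S \subseteq V(G)$ is a decycling set of $G$ if the graph $G - S$ obtained by deleting the vertices of $S$ is acyclic (a forest). The decycling number $\nabla(G)$ is the minimum cardinality of a decycling set of $G$. $C_n$ denotes the cycle on $n$ vertices. For a graph $G$ and positive integer $m$, the $m$-th power $G^{m}$ is the simple graph with $V(G^m)=V(G)$ in which two distinct vertices $u,v$ are adjacent iff their distance in $G$ satisfies $d_G(u,v) \leq m$. -}

module Defs where

open import Data.Nat using (ℕ; zero; suc; _+_; _≤_; _%_; NonZero)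
open import Data.Nat.DivMod using (m%n<n; _/_)
open import Data.Empty using (⊥)
open import Data.Fin using (Fin; toℕ; fromℕ<)
open import Data.Fin.Subset using (Subset; _∈_; _∉_; ∣_∣)
open import Data.Product using (Σ; ∃; ∃-syntax; _×_)
open import Data.Sum using (_⊎_)
open import Function.Definitions using (Injective)
open import Relation.Binary.PropositionalEquality using (_≡_; _≢_)

Graph : ℕ → Set₁
Graph n = Fin n → Fin n → Set

Cycle : (n : ℕ) → Graph n
Cycle (suc n) i j = (toℕ j ≡ (suc (toℕ i)) % suc n) ⊎ (toℕ i ≡ (suc (toℕ j)) % suc n)
Cycle zero () _

data Walk {n : ℕ} (G : Graph n) : ℕ → Fin n → Fin n → Set where
  here : ∀ {u} → Walk G 0 u u
  step : ∀ {k u v w} → G u v → Walk G k v w → Walk G (suc k) u w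

DistLe : {n : ℕ} → Graph n → Fin n → Fin n → ℕ → Set
DistLe G u v m = ∃[ k ] (k ≤ m × Walk G k u v)

Power : {n : ℕ} → Graph n → ℕ → Graph n
Power G m u v = u ≢ v × DistLe G u v m

cycNext : {m : ℕ} → Fin (suc m) → Fin (suc m)
cycNext {m} i = fromℕ< (m%n<n (suc (toℕ i)) (suc m))

-- G - S contains a cycle: distinct vertices f 0, …, f (k+2) (k+3 ≥ 3 of them),
-- none in S, with f i adjacent to f (i+1 mod (k+3)).
HasCycleAvoiding : {n : ℕ} → Graph n → Subset n → Set
HasCycleAvoiding {n} G S =
  ∃[ k ] Σ (Fin (suc (suc (suc k))) → Fin n) λ f →
    Injective _≡_ _≡_ f × (∀ i → f i ∉ S) × (∀ i → G (f i) (f (cycNext i)))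

IsDecyclingSet : {n : ℕ} → Graph n → Subset n → Set
IsDecyclingSet G S = HasCycleAvoiding G S → ⊥

IsDecyclingNumber : {n : ℕ} → Graph n → ℕ → Set
IsDecyclingNumber {n} G d =
  (Σ (Subset n) λ S → IsDecyclingSet G S × ∣ S ∣ ≡ d)
  × (∀ (S : Subset n) → IsDecyclingSet G S → d ≤ ∣ S ∣)

ceil3 : ℕ → ℕ
ceil3 a = (a + 2) / 3

-- Write n = m + 1 and label the vertices 0, …, m. For n ≥ 4 the decycling number is ⌈(n + 2)/3⌉,
-- which the case distinction of the statement merely rewrites in terms of ⌈(n + 1)/3⌉.
--
-- Lower bound: any three cyclically consecutive vertices span a triangle, so a decycling set S meets
-- every such window, and summing over the n windows gives 3|S| ≥ n. If two members of S are adjacent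
-- on C_n, the two windows containing both of them count twice each, so 3|S| ≥ n + 2. Otherwise the
-- non-members, visited in cyclic order, are one or two apart and hence form a cycle of C_n² − S as
-- soon as n ≥ 5; for n = 4 already 3|S| ≥ 4 forces |S| ≥ 2.
--
-- Upper bound: S₀ = {0} ∪ {1 + 3t}. Its complement avoids 0 and 1, so its edges join labels one or
-- two apart, and among the two labels just below a label outside S₀ at most one is outside S₀. Hence
-- the highest vertex of a cycle in C_n² − S₀ would have equal neighbours on the cycle.

module Submission where

open import Defs
open import Data.Nat using (ℕ; zero; suc; _+_; _*_; _∸_; _%_; _/_; _≤_; _<_; z≤n; s≤s; s≤s⁻¹; NonZero; _≟_; _≤?_; _<?_)
open import Data.Nat.Properties
open import Data.Nat.DivMod
open import Data.Bool using (Bool; true; false; if_then_else_)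
import Data.Bool.Properties as Bool
open import Data.Nat.GeneralisedArithmetic using (fold)
open import Data.Fin using (Fin; zero; suc; toℕ; fromℕ<)
open import Data.Fin.Properties using (toℕ-injective; toℕ-fromℕ<; fromℕ<-cong; toℕ<n; any?)
open import Data.Fin.Subset using (Subset; _∉_; ∣_∣)
open import Data.Vec using ([]; _∷_; lookup; tabulate)
open import Data.Vec.Properties using ([]=⇒lookup; lookup⇒[]=; lookup∘tabulate)
open import Data.Sum using (_⊎_; inj₁; inj₂; swap)
open import Data.Empty using (⊥; ⊥-elim)
open import Data.Product using (∃-syntax; _×_; _,_; proj₁; proj₂)
open import Data.Nat.Tactic.RingSolver using (solve-∀)
open import Relation.Nullary using (yes; no)
open import Relation.Nullary.Decidable using (_×-dec_)
open import Relation.Binary.Definitions using (tri<; tri≈; tri>)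
open import Algebra.Properties.CommutativeSemigroup +-commutativeSemigroup using (interchange)
open import Function using (_∘_)
open import Relation.Binary.PropositionalEquality

𝟙 : Bool → ℕ
𝟙 true  = 1
𝟙 false = 0

∑ : ℕ → (ℕ → ℕ) → ℕ
∑ zero    f = 0
∑ (suc n) f = f 0 + ∑ n (f ∘ suc)

∑-cong : ∀ n {f g} → (∀ i → f i ≡ g i) → ∑ n f ≡ ∑ n g
∑-cong zero    f≗g = refl
∑-cong (suc n) f≗g = cong₂ _+_ (f≗g 0) (∑-cong n (f≗g ∘ suc))

∑-snoc : ∀ n f → ∑ (suc n) f ≡ ∑ n f + f n
∑-snoc zero    f = +-comm (f 0) 0
∑-snoc (suc n) f = trans (cong (f 0 +_) (∑-snoc n (f ∘ suc))) (sym (+-assoc (f 0) _ _))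

∑-+ : ∀ n f g → ∑ n (λ i → f i + g i) ≡ ∑ n f + ∑ n g
∑-+ zero    f g = refl
∑-+ (suc n) f g = trans (cong (f 0 + g 0 +_) (∑-+ n (f ∘ suc) (g ∘ suc))) (interchange (f 0) (g 0) _ _)

∑-shift : ∀ n f → f n ≡ f 0 → ∑ n (f ∘ suc) ≡ ∑ n f
∑-shift n f fn≡f0 = +-cancelˡ-≡ (f 0) _ _ (begin
  ∑ (suc n) f     ≡⟨ ∑-snoc n f ⟩
  ∑ n f + f n     ≡⟨ cong (∑ n f +_) fn≡f0 ⟩
  ∑ n f + f 0     ≡⟨ +-comm (∑ n f) (f 0) ⟩
  f 0 + ∑ n f     ∎)
  where open ≡-Reasoning

∑-rotate : ∀ n f → (∀ i → f (i + n) ≡ f i) → ∀ j → ∑ n (λ i → f (j + i)) ≡ ∑ n f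
∑-rotate n f periodic zero    = refl
∑-rotate n f periodic (suc j) = begin
  ∑ n (λ i → f (suc j + i))   ≡⟨ ∑-cong n (λ i → cong f (sym (+-suc j i))) ⟩
  ∑ n (λ i → f (j + suc i))   ≡⟨ ∑-shift n (λ i → f (j + i)) (trans (periodic j) (cong f (sym (+-identityʳ j)))) ⟩
  ∑ n (λ i → f (j + i))       ≡⟨ ∑-rotate n f periodic j ⟩
  ∑ n f                       ∎
  where open ≡-Reasoning

∑-positive : ∀ n f → (∀ i → 0 < f i) → n ≤ ∑ n f
∑-positive zero    f f>0 = z≤n
∑-positive (suc n) f f>0 = +-mono-≤ (f>0 0) (∑-positive n (f ∘ suc) (f>0 ∘ suc))

∑-positive-ends≥2 : ∀ k f → (∀ i → 0 < f i) → 0 < k → 2 ≤ f 0 → 2 ≤ f k → suc k + 2 ≤ ∑ (suc k) f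
∑-positive-ends≥2 (suc k) f f>0 _ 2≤first 2≤last = begin
  2 + (k + 2)                        ≤⟨ +-mono-≤ 2≤first (+-mono-≤ (∑-positive k (f ∘ suc) (f>0 ∘ suc)) 2≤last) ⟩
  f 0 + (∑ k (f ∘ suc) + f (suc k))  ≡⟨ cong (f 0 +_) (∑-snoc k (f ∘ suc)) ⟨
  ∑ (suc (suc k)) f                  ∎
  where open ≤-Reasoning

∣p∣≡∑ : ∀ {k} (p : Subset k) (h : ℕ → Bool) →
        (∀ i (i<k : i < k) → lookup p (fromℕ< i<k) ≡ h i) → ∣ p ∣ ≡ ∑ k (𝟙 ∘ h)
∣p∣≡∑ []      h p≗h = refl
∣p∣≡∑ (x ∷ p) h p≗h with h 0 | p≗h 0 (s≤s z≤n)
... | true  | refl = cong suc (∣p∣≡∑ p (h ∘ suc) (λ i i<k → p≗h (suc i) (s≤s i<k)))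
... | false | refl = ∣p∣≡∑ p (h ∘ suc) (λ i i<k → p≗h (suc i) (s≤s i<k))

lookup≡false⇒∉ : ∀ {k} (p : Subset k) i → lookup p i ≡ false → i ∉ p
lookup≡false⇒∉ p i p[i]≡false i∈p with () ← trans (sym ([]=⇒lookup i∈p)) p[i]≡false

∉⇒lookup≡false : ∀ {k} (p : Subset k) i → i ∉ p → lookup p i ≡ false
∉⇒lookup≡false p i i∉p with lookup p i in p[i]
... | true  = ⊥-elim (i∉p (lookup⇒[]= i p p[i]))
... | false = refl

[m+n%o]%o≡[m+n]%o : ∀ m n o .{{_ : NonZero o}} → (m + n % o) % o ≡ (m + n) % o
[m+n%o]%o≡[m+n]%o m n o = begin
  (m + n % o) % o            ≡⟨ %-distribˡ-+ m (n % o) o ⟩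
  (m % o + n % o % o) % o    ≡⟨ cong (λ r → (m % o + r) % o) (m%n%n≡m%n n o) ⟩
  (m % o + n % o) % o        ≡⟨ %-distribˡ-+ m n o ⟨
  (m + n) % o                ∎
  where open ≡-Reasoning

m<n<m+o⇒m%o≢n%o : ∀ {m n} o .{{_ : NonZero o}} → m < n → n < m + o → m % o ≢ n % o
m<n<m+o⇒m%o≢n%o {m} {n} o m<n n<m+o m%o≡n%o =
  residue≢shifted (m%n<n m o) (m<n⇒0<n∸m m<n) (m<n+o⇒m∸n<o n m n<m+o) (begin
    m % o                ≡⟨ m%o≡n%o ⟩
    n % o                ≡⟨ cong (_% o) (m+[n∸m]≡n (<⇒≤ m<n)) ⟨
    (m + d) % o          ≡⟨ cong (_% o) (+-comm m d) ⟩
    (d + m) % o          ≡⟨ [m+n%o]%o≡[m+n]%o d m o ⟨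
    (d + m % o) % o      ≡⟨ cong (_% o) (+-comm d (m % o)) ⟩
    (m % o + d) % o      ∎)
  where
  open ≡-Reasoning
  d = n ∸ m
  residue≢shifted : ∀ {r e} → r < o → 0 < e → e < o → r ≢ (r + e) % o
  residue≢shifted {r} {e} r<o 0<e e<o r≡ with r + e <? o
  ... | yes r+e<o = <⇒≢ (m<m+n r 0<e) (trans r≡ (m<n⇒m%n≡m r+e<o))
  ... | no  r+e≮o = <⇒≢ e<o (sym (+-cancelˡ-≡ r _ _ (begin
    r + o              ≡⟨ cong (_+ o) r≡r+e∸o ⟩
    r + e ∸ o + o      ≡⟨ m∸n+n≡m o≤r+e ⟩
    r + e              ∎)))
    where
    o≤r+e = ≮⇒≥ r+e≮o
    r≡r+e∸o : r ≡ r + e ∸ o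
    r≡r+e∸o = begin
      r                      ≡⟨ r≡ ⟩
      (r + e) % o            ≡⟨ m≤n⇒[n∸m]%m≡n%m o≤r+e ⟨
      (r + e ∸ o) % o        ≡⟨ m<n⇒m%n≡m (m<n+o⇒m∸n<o (r + e) o (+-mono-< r<o e<o)) ⟩
      r + e ∸ o              ∎

[3+m]/3≡1+m/3 : ∀ m → (3 + m) / 3 ≡ 1 + m / 3
[3+m]/3≡1+m/3 m = m/n≡1+[m∸n]/n (m≤m+n 3 m)

4≤3*c⇒6≤3*c : ∀ {c} → 4 ≤ 3 * c → 6 ≤ 3 * c
4≤3*c⇒6≤3*c {suc zero} (s≤s (s≤s (s≤s ())))
4≤3*c⇒6≤3*c {suc (suc c)} _ = *-monoʳ-≤ 3 (s≤s (s≤s z≤n))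

module _ {l : ℕ} where

  mod-cong : ∀ a b → a % suc l ≡ b % suc l → a mod suc l ≡ b mod suc l
  mod-cong a b a≡b = fromℕ<-cong _ _ a≡b _ _

  cycNext-mod : ∀ a → cycNext (a mod suc l) ≡ suc a mod suc l
  cycNext-mod a = mod-cong (suc (toℕ (a mod suc l))) (suc a) (begin
    suc (toℕ (a mod suc l)) % suc l ≡⟨ cong (λ r → suc r % suc l) (toℕ-fromℕ< _) ⟩
    (1 + a % suc l) % suc l         ≡⟨ [m+n%o]%o≡[m+n]%o 1 a (suc l) ⟩
    suc a % suc l                   ∎)
    where open ≡-Reasoning

  toℕ-mod : ∀ (i : Fin (suc l)) → toℕ i mod suc l ≡ i
  toℕ-mod i = toℕ-injective (trans (toℕ-fromℕ< _) (m<n⇒m%n≡m (toℕ<n i)))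

  cycPrev : Fin (suc l) → Fin (suc l)
  cycPrev i = (toℕ i + l) mod suc l

  cycNext∘cycPrev : ∀ i → cycNext (cycPrev i) ≡ i
  cycNext∘cycPrev i = begin
    cycNext ((toℕ i + l) mod suc l) ≡⟨ cycNext-mod (toℕ i + l) ⟩
    suc (toℕ i + l) mod suc l       ≡⟨ mod-cong (suc (toℕ i + l)) (toℕ i) (trans (cong (_% suc l) (sym (+-suc (toℕ i) l))) ([m+n]%n≡m%n (toℕ i) (suc l))) ⟩
    toℕ i mod suc l                 ≡⟨ toℕ-mod i ⟩
    i                               ∎
    where open ≡-Reasoning

  cycPrev≢cycNext : 2 ≤ l → ∀ i → cycPrev i ≢ cycNext i
  cycPrev≢cycNext 2≤l i prev≡next = m<n<m+o⇒m%o≢n%o (suc l) (m<m+n m (s≤s z≤n)) (+-monoʳ-< m (s≤s 2≤l)) (begin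
    m % suc l                  ≡⟨ toℕ-fromℕ< _ ⟨
    toℕ (cycPrev i)            ≡⟨ cong toℕ prev≡next ⟩
    toℕ (cycNext i)            ≡⟨ toℕ-fromℕ< _ ⟩
    suc (toℕ i) % suc l        ≡⟨ [m+n]%n≡m%n (suc (toℕ i)) (suc l) ⟨
    (suc (toℕ i) + suc l) % suc l ≡⟨ cong (_% suc l) (+2≡ (toℕ i) l) ⟨
    (m + 2) % suc l            ∎)
    where
    open ≡-Reasoning
    m = toℕ i + l
    +2≡ : ∀ i l → i + l + 2 ≡ suc i + suc l
    +2≡ = solve-∀

argmax : ∀ {l} (h : Fin (suc l) → ℕ) → ∃[ i ] (∀ j → h j ≤ h i)
argmax {zero}  h = zero , λ { zero → ≤-refl }
argmax {suc l} h with argmax (h ∘ suc)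
... | i , max with h zero ≤? h (suc i)
...   | yes h0≤ = suc i , λ { zero → h0≤ ; (suc j) → max j }
...   | no  h0≰ = zero , λ { zero → ≤-refl ; (suc j) → ≤-trans (max j) (<⇒≤ (≰⇒> h0≰)) }

-- The two cycle neighbours of a highest vertex of a cycle are distinct and not higher than it.
unique-lower-neighbour⇒decycling : ∀ {n} (G : Graph n) (S : Subset n) →
  (∀ {u w w′} → u ∉ S → w ∉ S → w′ ∉ S → G w u → G u w′ → toℕ w ≤ toℕ u → toℕ w′ ≤ toℕ u → w ≡ w′) →
  IsDecyclingSet G S
unique-lower-neighbour⇒decycling G S unique (k , f , f-inj , avoid , adj) =
  cycPrev≢cycNext (s≤s (s≤s z≤n)) top
    (f-inj (unique (avoid top) (avoid prev) (avoid next) prev–top (adj top) (highest prev) (highest next)))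
  where
  top     = proj₁ (argmax (toℕ ∘ f))
  highest = proj₂ (argmax (toℕ ∘ f))
  prev    = cycPrev top
  next    = cycNext top
  prev–top : G (f prev) (f top)
  prev–top = subst (λ i → G (f prev) (f i)) (cycNext∘cycPrev top) (adj prev)

2≤⇒≢0 : ∀ {t} → 2 ≤ t → t ≢ 0
2≤⇒≢0 2≤t = >⇒≢ (≤-trans (s≤s z≤n) 2≤t)

Hop : ℕ → ℕ → Set
Hop a b = b ≡ suc a ⊎ b ≡ suc (suc a)

Hop⇒< : ∀ {a b} → Hop a b → a < b
Hop⇒< (inj₁ refl) = ≤-refl
Hop⇒< (inj₂ refl) = n≤1+n _

Hop⇒≤2+ : ∀ {a b} → Hop a b → b ≤ 2 + a
Hop⇒≤2+ (inj₁ refl) = n≤1+n _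
Hop⇒≤2+ (inj₂ refl) = ≤-refl

divisibleBy3 : ℕ → Bool
divisibleBy3 0                   = true
divisibleBy3 1                   = false
divisibleBy3 2                   = false
divisibleBy3 (suc (suc (suc t))) = divisibleBy3 t

∑-divisibleBy3 : ∀ k → ∑ k (𝟙 ∘ divisibleBy3) ≡ (k + 2) / 3
∑-divisibleBy3 0                   = refl
∑-divisibleBy3 1                   = refl
∑-divisibleBy3 2                   = refl
∑-divisibleBy3 (suc (suc (suc k))) = trans (cong suc (∑-divisibleBy3 k)) (sym ([3+m]/3≡1+m/3 (k + 2)))

MeetsEveryTriple : (ℕ → Bool) → Set
MeetsEveryTriple p = ∀ t → p t ≡ false → p (suc t) ≡ false → p (suc (suc t)) ≡ false → ⊥

divisibleBy3-meetsEveryTriple : MeetsEveryTriple divisibleBy3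
divisibleBy3-meetsEveryTriple 0                   ()
divisibleBy3-meetsEveryTriple 1                   _  _ ()
divisibleBy3-meetsEveryTriple 2                   _  ()
divisibleBy3-meetsEveryTriple (suc (suc (suc t))) = divisibleBy3-meetsEveryTriple t

tripleCount : (ℕ → Bool) → ℕ → ℕ
tripleCount p a = 𝟙 (p a) + (𝟙 (p (suc a)) + 𝟙 (p (suc (suc a))))

tripleCount-positive : ∀ {p} → MeetsEveryTriple p → ∀ a → 0 < tripleCount p a
tripleCount-positive {p} meets a with p a in e₀ | p (suc a) in e₁ | p (suc (suc a)) in e₂
... | true  | _     | _     = s≤s z≤n
... | false | true  | _     = s≤s z≤n
... | false | false | true  = s≤s z≤n
... | false | false | false = ⊥-elim (meets a e₀ e₁ e₂)

Hop-unique : ∀ {p} → MeetsEveryTriple p → ∀ {y z b} → Hop y b → Hop z b →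
             p b ≡ false → p y ≡ false → p z ≡ false → y ≡ z
Hop-unique meets (inj₁ refl) (inj₁ refl) _ _ _ = refl
Hop-unique meets (inj₂ refl) (inj₂ refl) _ _ _ = refl
Hop-unique meets {z = z} (inj₁ refl) (inj₂ b≡) pb py pz with refl ← suc-injective b≡ = ⊥-elim (meets z pz py pb)
Hop-unique meets {y = y} (inj₂ refl) (inj₁ b≡) pb py pz with refl ← suc-injective b≡ = ⊥-elim (meets y py pz pb)

<≤2+⇒Hop : ∀ {a b} → a < b → b ≤ 2 + a → Hop a b
<≤2+⇒Hop a<b b≤2+a with m≤n⇒m<n∨m≡n a<b
... | inj₁ 1+a<b = inj₂ (≤-antisym b≤2+a 1+a<b)
... | inj₂ 1+a≡b = inj₁ (sym 1+a≡b)

module _ {x : ℕ → ℕ} (x-increasing : ∀ j → x j < x (suc j)) where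

  increasing-< : ∀ {i j} → i < j → x i < x j
  increasing-< {i} {suc j} (s≤s i≤j) with m≤n⇒m<n∨m≡n i≤j
  ... | inj₁ i<j  = <-trans (increasing-< i<j) (x-increasing j)
  ... | inj₂ refl = x-increasing i

  increasing-≤ : ∀ {i j} → i ≤ j → x i ≤ x j
  increasing-≤ i≤j with m≤n⇒m<n∨m≡n i≤j
  ... | inj₁ i<j  = <⇒≤ (increasing-< i<j)
  ... | inj₂ refl = ≤-refl

  crossing : ∀ N → x 0 < N → ∃[ j ] x j < N × N ≤ x (suc j)
  crossing (suc N) x₀<1+N with m≤n⇒m<n∨m≡n (s≤s⁻¹ x₀<1+N)
  ... | inj₂ refl = 0 , x₀<1+N , x-increasing 0
  ... | inj₁ x₀<N with crossing N x₀<N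
  ...   | j , xj<N , N≤xj+1 with m≤n⇒m<n∨m≡n N≤xj+1
  ...     | inj₁ N<xj+1 = j , <-trans xj<N (n<1+n N) , N<xj+1
  ...     | inj₂ refl   = suc j , n<1+n N , x-increasing (suc j)

module CycleSquare (m : ℕ) where

  n : ℕ
  n = suc m

  C² : Graph n
  C² = Power (Cycle n) 2

  Cycle-step : ∀ a → Cycle n (a mod n) (suc a mod n)
  Cycle-step a = subst (Cycle n (a mod n)) (cycNext-mod a) (inj₁ (toℕ-fromℕ< _))

  Hop⇒mod-≢ : 2 ≤ m → ∀ {a b} → Hop a b → a mod n ≢ b mod n
  Hop⇒mod-≢ 2≤m {a} {b} hop a≡b = m<n<m+o⇒m%o≢n%o n (Hop⇒< hop) b<a+n
    (trans (sym (toℕ-fromℕ< _)) (trans (cong toℕ a≡b) (toℕ-fromℕ< _)))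
    where
    b<a+n : b < a + n
    b<a+n = ≤-<-trans (Hop⇒≤2+ hop) (subst (2 + a <_) (+-comm n a) (+-monoˡ-< a (s≤s 2≤m)))

  Hop⇒C² : 2 ≤ m → ∀ {a b} → Hop a b → C² (a mod n) (b mod n)
  Hop⇒C² 2≤m {a} hop@(inj₁ refl) = Hop⇒mod-≢ 2≤m hop , 1 , s≤s z≤n , step (Cycle-step a) here
  Hop⇒C² 2≤m {a} hop@(inj₂ refl) = Hop⇒mod-≢ 2≤m hop , 2 , ≤-refl , step (Cycle-step a) (step (Cycle-step (suc a)) here)

  Hop⇒C²ʳ : 2 ≤ m → ∀ {a b} → Hop a b → C² (b mod n) (a mod n)
  Hop⇒C²ʳ 2≤m {a} hop@(inj₁ refl) =
    Hop⇒mod-≢ 2≤m hop ∘ sym , 1 , s≤s z≤n , step (swap (Cycle-step a)) here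
  Hop⇒C²ʳ 2≤m {a} hop@(inj₂ refl) =
    Hop⇒mod-≢ 2≤m hop ∘ sym , 2 , ≤-refl , step (swap (Cycle-step (suc a))) (step (swap (Cycle-step a)) here)

  -- The labels x 0 < … < x (2 + k) lie in a window shorter than n, so their residues are distinct.
  Hop-cycle : 2 ≤ m → ∀ (S : Subset n) k (x : ℕ → ℕ) → (∀ j → Hop (x j) (x (suc j))) →
              x (2 + k) < x 0 + n → C² (x (2 + k) mod n) (x 0 mod n) →
              (∀ (i : Fin (3 + k)) → x (toℕ i) mod n ∉ S) → HasCycleAvoiding C² S
  Hop-cycle 2≤m S k x hop short closing avoid = k , f , f-injective , avoid , f-adjacent
    where
    f : Fin (3 + k) → Fin n
    f i = x (toℕ i) mod n

    x-increasing : ∀ j → x j < x (suc j)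
    x-increasing j = Hop⇒< (hop j)

    residues-differ : ∀ {i j} → i < j → j ≤ 2 + k → x i % n ≢ x j % n
    residues-differ {i} {j} i<j j≤2+k = m<n<m+o⇒m%o≢n%o n (increasing-< x-increasing i<j) (begin-strict
      x j          ≤⟨ increasing-≤ x-increasing j≤2+k ⟩
      x (2 + k)    <⟨ short ⟩
      x 0 + n      ≤⟨ +-monoˡ-≤ n (increasing-≤ x-increasing z≤n) ⟩
      x i + n      ∎)
      where open ≤-Reasoning

    residues-injective : ∀ {i j : Fin (3 + k)} → x (toℕ i) % n ≡ x (toℕ j) % n → i ≡ j
    residues-injective {i} {j} xi≡xj with <-cmp (toℕ i) (toℕ j)
    ... | tri< i<j _ _ = ⊥-elim (residues-differ i<j (s≤s⁻¹ (toℕ<n j)) xi≡xj)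
    ... | tri≈ _ i≡j _ = toℕ-injective i≡j
    ... | tri> _ _ j<i = ⊥-elim (residues-differ j<i (s≤s⁻¹ (toℕ<n i)) (sym xi≡xj))

    f-injective : ∀ {i j} → f i ≡ f j → i ≡ j
    f-injective fi≡fj = residues-injective (trans (sym (toℕ-fromℕ< _)) (trans (cong toℕ fi≡fj) (toℕ-fromℕ< _)))

    f-adjacent : ∀ i → C² (f i) (f (cycNext i))
    f-adjacent i with toℕ i <? 2 + k
    ... | yes i<2+k = subst (λ j → C² (f i) (x j mod n)) (sym next≡) (Hop⇒C² 2≤m (hop (toℕ i)))
      where
      next≡ : toℕ (cycNext i) ≡ suc (toℕ i)
      next≡ = trans (toℕ-fromℕ< _) (m<n⇒m%n≡m (s≤s i<2+k))
    ... | no  i≮2+k = subst₂ (λ a b → C² (x a mod n) (x b mod n)) (sym i≡2+k) (sym next≡) closing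
      where
      i≡2+k : toℕ i ≡ 2 + k
      i≡2+k = ≤-antisym (s≤s⁻¹ (toℕ<n i)) (≮⇒≥ i≮2+k)
      next≡ : toℕ (cycNext i) ≡ 0
      next≡ = trans (toℕ-fromℕ< _) (trans (cong (λ t → suc t % (3 + k)) i≡2+k) (n%n≡0 (3 + k)))

  suc-%-cases : ∀ (i : Fin n) → suc (toℕ i) % n ≡ suc (toℕ i) ⊎ (toℕ i ≡ m × suc (toℕ i) % n ≡ 0)
  suc-%-cases i with toℕ i <? m
  ... | yes i<m = inj₁ (m<n⇒m%n≡m (s≤s i<m))
  ... | no  i≮m = inj₂ (i≡m , trans (cong (λ t → suc t % n) i≡m) (n%n≡0 n))
    where
    i≡m = ≤-antisym (s≤s⁻¹ (toℕ<n i)) (≮⇒≥ i≮m)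

  Cycle-linear : ∀ {u w} → Cycle n u w → toℕ u ≢ 0 → toℕ w ≢ 0 →
                 toℕ w ≡ suc (toℕ u) ⊎ toℕ u ≡ suc (toℕ w)
  Cycle-linear {u} (inj₁ w≡) _ w≢0 with suc-%-cases u
  ... | inj₁ e       = inj₁ (trans w≡ e)
  ... | inj₂ (_ , e) = ⊥-elim (w≢0 (trans w≡ e))
  Cycle-linear {w = w} (inj₂ u≡) u≢0 _ with suc-%-cases w
  ... | inj₁ e       = inj₂ (trans u≡ e)
  ... | inj₂ (_ , e) = ⊥-elim (u≢0 (trans u≡ e))

  Cycle-to-0 : 1 ≤ m → ∀ {u z} → Cycle n u z → toℕ z ≡ 0 → toℕ u ≡ 1 ⊎ toℕ u ≡ m
  Cycle-to-0 1≤m {u} (inj₁ z≡) z≡0 with suc-%-cases u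
  ... | inj₁ e        with () ← trans (sym z≡0) (trans z≡ e)
  ... | inj₂ (u≡m , _) = inj₂ u≡m
  Cycle-to-0 1≤m (inj₂ u≡) z≡0 = inj₁ (trans u≡ (trans (cong (λ t → suc t % n) z≡0) (m<n⇒m%n≡m (s≤s 1≤m))))

  C²-linear : 1 ≤ m → ∀ {u w} → 2 ≤ toℕ u → 2 ≤ toℕ w → C² u w →
              Hop (toℕ u) (toℕ w) ⊎ Hop (toℕ w) (toℕ u)
  C²-linear _ _ _ (u≢u , 0 , _ , here) = ⊥-elim (u≢u refl)
  C²-linear _ 2≤u 2≤w (_ , 1 , _ , step u–w here) with Cycle-linear u–w (2≤⇒≢0 2≤u) (2≤⇒≢0 2≤w)
  ... | inj₁ w≡1+u = inj₁ (inj₁ w≡1+u)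
  ... | inj₂ u≡1+w = inj₂ (inj₁ u≡1+w)
  C²-linear 1≤m {u} {w} 2≤u 2≤w (u≢w , 2 , _ , step {v = z} u–z (step z–w here)) with toℕ z ≟ 0
  ... | yes z≡0 = ⊥-elim (u≢w (toℕ-injective (trans (top u–z 2≤u) (sym (top (swap z–w) 2≤w)))))
    where
    top : ∀ {x} → Cycle n x z → 2 ≤ toℕ x → toℕ x ≡ m
    top x–z 2≤x with Cycle-to-0 1≤m x–z z≡0
    ... | inj₁ x≡1 = ⊥-elim (>⇒≢ 2≤x x≡1)
    ... | inj₂ x≡m = x≡m
  ... | no z≢0 with Cycle-linear u–z (2≤⇒≢0 2≤u) z≢0 | Cycle-linear z–w z≢0 (2≤⇒≢0 2≤w)
  ... | inj₁ z≡1+u | inj₁ w≡1+z = inj₁ (inj₂ (trans w≡1+z (cong suc z≡1+u)))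
  ... | inj₂ u≡1+z | inj₂ z≡1+w = inj₂ (inj₂ (trans u≡1+z (cong suc z≡1+w)))
  ... | inj₁ z≡1+u | inj₂ z≡1+w = ⊥-elim (u≢w (toℕ-injective (suc-injective (trans (sym z≡1+u) z≡1+w))))
  ... | inj₂ u≡1+z | inj₁ w≡1+z = ⊥-elim (u≢w (toℕ-injective (trans u≡1+z (sym w≡1+z))))
  C²-linear _ _ _ (_ , suc (suc (suc _)) , s≤s (s≤s ()) , _)

  inS₀ : ℕ → Bool
  inS₀ zero    = true
  inS₀ (suc t) = divisibleBy3 t

  inS₀-meetsEveryTriple : MeetsEveryTriple inS₀
  inS₀-meetsEveryTriple zero    ()
  inS₀-meetsEveryTriple (suc t) = divisibleBy3-meetsEveryTriple t

  inS₀≡false⇒2≤ : ∀ {t} → inS₀ t ≡ false → 2 ≤ t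
  inS₀≡false⇒2≤ {suc (suc t)} _ = s≤s (s≤s z≤n)

  S₀ : Subset n
  S₀ = tabulate (inS₀ ∘ toℕ)

  ∉S₀⇒inS₀≡false : ∀ {u} → u ∉ S₀ → inS₀ (toℕ u) ≡ false
  ∉S₀⇒inS₀≡false {u} u∉S₀ = trans (sym (lookup∘tabulate (inS₀ ∘ toℕ) u)) (∉⇒lookup≡false S₀ u u∉S₀)

  ∣S₀∣ : ∣ S₀ ∣ ≡ ceil3 (n + 2)
  ∣S₀∣ = begin
    ∣ S₀ ∣                          ≡⟨ ∣p∣≡∑ S₀ inS₀ (λ i i<n → trans (lookup∘tabulate (inS₀ ∘ toℕ) (fromℕ< i<n)) (cong inS₀ (toℕ-fromℕ< i<n))) ⟩
    1 + ∑ m (𝟙 ∘ divisibleBy3)      ≡⟨ cong suc (∑-divisibleBy3 m) ⟩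
    1 + (m + 2) / 3                 ≡⟨ [3+m]/3≡1+m/3 (m + 2) ⟨
    (3 + (m + 2)) / 3               ≡⟨ cong (_/ 3) (3+[m+2]≡ m) ⟩
    (n + 2 + 2) / 3                 ∎
    where
    open ≡-Reasoning
    3+[m+2]≡ : ∀ m → 3 + (m + 2) ≡ suc m + 2 + 2
    3+[m+2]≡ = solve-∀

  Hop-orient : ∀ {a b} → Hop a b ⊎ Hop b a → a ≤ b → Hop a b
  Hop-orient (inj₁ hop) _   = hop
  Hop-orient (inj₂ hop) a≤b = ⊥-elim (<⇒≱ (Hop⇒< hop) a≤b)

  S₀-decycling : 1 ≤ m → IsDecyclingSet C² S₀
  S₀-decycling 1≤m = unique-lower-neighbour⇒decycling C² S₀ λ {u} {w} {w′} u∉ w∉ w′∉ w–u u–w′ w≤u w′≤u →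
    toℕ-injective (Hop-unique inS₀-meetsEveryTriple
      (Hop-orient (C²-linear 1≤m (outside w∉) (outside u∉) w–u) w≤u)
      (Hop-orient (swap (C²-linear 1≤m (outside u∉) (outside w′∉) u–w′)) w′≤u)
      (∉S₀⇒inS₀≡false u∉) (∉S₀⇒inS₀≡false w∉) (∉S₀⇒inS₀≡false w′∉))
    where
    outside : ∀ {x} → x ∉ S₀ → 2 ≤ toℕ x
    outside = inS₀≡false⇒2≤ ∘ ∉S₀⇒inS₀≡false

  module LowerBound (S : Subset n) (S-decycling : IsDecyclingSet C² S) (3≤m : 3 ≤ m) where

    2≤m : 2 ≤ m
    2≤m = ≤-trans (n≤1+n 2) 3≤m

    inS : ℕ → Bool
    inS a = lookup S (a mod n)

    inS-periodic : ∀ a → inS (a + n) ≡ inS a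
    inS-periodic a = cong (lookup S) (mod-cong (a + n) a ([m+n]%n≡m%n a n))

    ∣S∣≡∑ : ∣ S ∣ ≡ ∑ n (𝟙 ∘ inS)
    ∣S∣≡∑ = ∣p∣≡∑ S inS λ i i<n → cong (lookup S) (fromℕ<-cong i (i % n) (sym (m<n⇒m%n≡m i<n)) _ _)

    inS-meetsEveryTriple : MeetsEveryTriple inS
    inS-meetsEveryTriple a out₀ out₁ out₂ =
      S-decycling (Hop-cycle 2≤m S 0 (_+ a) (λ _ → inj₁ refl) short (Hop⇒C²ʳ 2≤m (inj₂ refl)) outside)
      where
      short : 2 + a < a + n
      short = subst (2 + a <_) (+-comm n a) (+-monoˡ-< a (s≤s 2≤m))
      outside : ∀ (i : Fin 3) → (toℕ i + a) mod n ∉ S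
      outside zero             = lookup≡false⇒∉ S _ out₀
      outside (suc zero)       = lookup≡false⇒∉ S _ out₁
      outside (suc (suc zero)) = lookup≡false⇒∉ S _ out₂

    triple : ℕ → ℕ
    triple = tripleCount inS

    ∑-triple : ∑ n triple ≡ 3 * ∣ S ∣
    ∑-triple = begin
      ∑ n triple                      ≡⟨ ∑-+ n B (λ a → B₁ a + B₂ a) ⟩
      ∑ n B + ∑ n (λ a → B₁ a + B₂ a) ≡⟨ cong (∑ n B +_) (∑-+ n B₁ B₂) ⟩
      ∑ n B + (∑ n B₁ + ∑ n B₂)       ≡⟨ cong₂ (λ s t → ∑ n B + (s + t)) shift₁ (trans shift₂ shift₁) ⟩
      ∑ n B + (∑ n B + ∑ n B)         ≡⟨ cong (λ t → ∑ n B + (∑ n B + t)) (+-identityʳ (∑ n B)) ⟨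
      3 * ∑ n B                       ≡⟨ cong (3 *_) ∣S∣≡∑ ⟨
      3 * ∣ S ∣                       ∎
      where
      open ≡-Reasoning
      B B₁ B₂ : ℕ → ℕ
      B a  = 𝟙 (inS a)
      B₁ a = B (suc a)
      B₂ a = B (suc (suc a))
      shift₁ : ∑ n B₁ ≡ ∑ n B
      shift₁ = ∑-shift n B (cong 𝟙 (inS-periodic 0))
      shift₂ : ∑ n B₂ ≡ ∑ n B₁
      shift₂ = ∑-shift n B₁ (cong 𝟙 (inS-periodic 1))

    n≤3∣S∣ : n ≤ 3 * ∣ S ∣
    n≤3∣S∣ = subst (n ≤_) ∑-triple (∑-positive n triple (tripleCount-positive inS-meetsEveryTriple))

    adjacent-pair⇒bound : ∀ a → inS a ≡ true → inS (suc a) ≡ true → n + 2 ≤ 3 * ∣ S ∣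
    adjacent-pair⇒bound a in₀ in₁ = begin
      n + 2                        ≤⟨ ∑-positive-ends≥2 m g (tripleCount-positive inS-meetsEveryTriple ∘ (a +_))
                                        (≤-trans (s≤s z≤n) 3≤m) g₀≥2 gₘ≥2 ⟩
      ∑ n g                        ≡⟨ ∑-rotate n triple triple-periodic a ⟩
      ∑ n triple                   ≡⟨ ∑-triple ⟩
      3 * ∣ S ∣                    ∎
      where
      open ≤-Reasoning
      g : ℕ → ℕ
      g i = triple (a + i)
      triple-periodic : ∀ i → triple (i + n) ≡ triple i
      triple-periodic i = cong₂ _+_ (cong 𝟙 (inS-periodic i))
        (cong₂ _+_ (cong 𝟙 (inS-periodic (suc i))) (cong 𝟙 (inS-periodic (suc (suc i)))))
      in-a+n : inS (suc (a + m)) ≡ true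
      in-a+n = trans (cong inS (sym (+-suc a m))) (trans (inS-periodic a) in₀)
      in-a+1+n : inS (suc (suc (a + m))) ≡ true
      in-a+1+n = trans (cong (inS ∘ suc) (sym (+-suc a m))) (trans (inS-periodic (suc a)) in₁)
      g₀≥2 : 2 ≤ g 0
      g₀≥2 rewrite +-identityʳ a | in₀ | in₁ = s≤s (s≤s z≤n)
      gₘ≥2 : 2 ≤ g m
      gₘ≥2 rewrite in-a+n | in-a+1+n = m≤n+m 2 (𝟙 (inS (a + m)))

    module Isolated (isolated : ∀ a → inS a ≡ true → inS (suc a) ≡ false) where

      next : ℕ → ℕ
      next y = if inS (suc y) then suc (suc y) else suc y

      next-hop : ∀ y → Hop y (next y)
      next-hop y with inS (suc y)
      ... | true  = inj₂ refl
      ... | false = inj₁ refl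

      next-outside : ∀ y → inS (next y) ≡ false
      next-outside y with inS (suc y) in in₁
      ... | true  = isolated (suc y) in₁
      ... | false = in₁

      start : ℕ
      start = if inS 0 then 1 else 0

      start-outside : inS start ≡ false
      start-outside with inS 0 in in₀
      ... | true  = isolated 0 in₀
      ... | false = in₀

      x : ℕ → ℕ
      x = fold start next

      x-outside : ∀ j → inS (x j) ≡ false
      x-outside zero    = start-outside
      x-outside (suc j) = next-outside (x j)

      x-hop : ∀ j → Hop (x j) (x (suc j))
      x-hop j = next-hop (x j)

      x-bound : ∀ j → x j ≤ j * 2 + x 0
      x-bound zero    = ≤-refl
      x-bound (suc j) = ≤-trans (Hop⇒≤2+ (x-hop j)) (s≤s (s≤s (x-bound j)))

      no-early-crossing : 4 ≤ m → ∀ j → j ≤ 1 → x 0 + n ≤ x (suc j) → ⊥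
      no-early-crossing 4≤m j j≤1 N≤x = <⇒≱ (s≤s 4≤m) (begin
        n            ≤⟨ +-cancelˡ-≤ (x 0) _ _ (≤-trans N≤x (≤-trans (x-bound (suc j)) (≤-reflexive (+-comm _ (x 0))))) ⟩
        suc j * 2    ≤⟨ *-monoˡ-≤ 2 (s≤s j≤1) ⟩
        4            ∎)
        where open ≤-Reasoning

      cycle : 4 ≤ m → HasCycleAvoiding C² S
      cycle 4≤m with crossing (Hop⇒< ∘ x-hop) (x 0 + n) (m<m+n (x 0) (s≤s z≤n))
      ... | 0           , _   , N≤x₁ = ⊥-elim (no-early-crossing 4≤m 0 z≤n N≤x₁)
      ... | 1           , _   , N≤x₂ = ⊥-elim (no-early-crossing 4≤m 1 ≤-refl N≤x₂)
      ... | suc (suc k) , x<N , N≤x  =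
        Hop-cycle 2≤m S k x x-hop x<N closing (λ i → lookup≡false⇒∉ S _ (x-outside (toℕ i)))
        where
        closing : C² (x (2 + k) mod n) (x 0 mod n)
        closing = subst (C² _) (mod-cong (x 0 + n) (x 0) ([m+n]%n≡m%n (x 0) n))
          (Hop⇒C² 2≤m (<≤2+⇒Hop x<N (≤-trans N≤x (Hop⇒≤2+ (x-hop (2 + k))))))

    lower-bound : n + 2 ≤ 3 * ∣ S ∣
    lower-bound with any? (λ i → (lookup S i Bool.≟ true) ×-dec (lookup S (cycNext i) Bool.≟ true))
    ... | yes (i , in₀ , in₁) = adjacent-pair⇒bound (toℕ i) (trans (cong (lookup S) (toℕ-mod i)) in₀) in₁
    ... | no  no-pair with m ≟ 3
    ...   | yes m≡3 = subst (λ t → suc t + 2 ≤ 3 * ∣ S ∣) (sym m≡3)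
                        (4≤3*c⇒6≤3*c {∣ S ∣} (subst (λ t → suc t ≤ 3 * ∣ S ∣) m≡3 n≤3∣S∣))
    ...   | no  m≢3 = ⊥-elim (S-decycling (Isolated.cycle isolated (≤∧≢⇒< 3≤m (m≢3 ∘ sym))))
      where
      isolated : ∀ a → inS a ≡ true → inS (suc a) ≡ false
      isolated a in₀ with inS (suc a) in in₁
      ... | true  = ⊥-elim (no-pair (a mod n , in₀ , trans (cong (lookup S) (cycNext-mod a)) in₁))
      ... | false = refl

ceil3-least : ∀ {a c} → a ≤ 3 * c → ceil3 a ≤ c
ceil3-least {a} {c} a≤3c = s≤s⁻¹ (m<n*o⇒m/o<n (begin-strict
  a + 2            ≤⟨ +-monoˡ-≤ 2 a≤3c ⟩
  3 * c + 2        <⟨ +-monoʳ-< (3 * c) (n<1+n 2) ⟩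
  3 * c + 3        ≡⟨ +-comm (3 * c) 3 ⟩
  3 + 3 * c        ≡⟨ cong (3 +_) (*-comm 3 c) ⟩
  suc c * 3        ∎))
  where open ≤-Reasoning

ceil3-3+ : ∀ a → ceil3 (3 + a) ≡ 1 + ceil3 a
ceil3-3+ a = [3+m]/3≡1+m/3 (a + 2)

ceil3-step : ∀ n → (n % 3 ≢ 2 → ceil3 (n + 2) ≡ ceil3 (n + 1))
               × (n % 3 ≡ 2 → ceil3 (n + 2) ≡ ceil3 (n + 1) + 1)
ceil3-step 0 = (λ _ → refl) , λ ()
ceil3-step 1 = (λ _ → refl) , λ ()
ceil3-step 2 = (λ 2≢2 → ⊥-elim (2≢2 refl)) , λ _ → refl
ceil3-step (suc (suc (suc n))) with ceil3-step n
... | ≢2⇒ , ≡2⇒ =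
  (λ n%3≢2 → trans (ceil3-3+ (n + 2)) (trans (cong suc (≢2⇒ n%3≢2)) (sym (ceil3-3+ (n + 1))))) ,
  (λ n%3≡2 → trans (ceil3-3+ (n + 2)) (trans (cong suc (≡2⇒ n%3≡2)) (cong (_+ 1) (sym (ceil3-3+ (n + 1))))))

decyclingNumber : ∀ m → 3 ≤ m → IsDecyclingNumber (Power (Cycle (suc m)) 2) (ceil3 (suc m + 2))
decyclingNumber m 3≤m =
  (S₀ , S₀-decycling (≤-trans (s≤s z≤n) 3≤m) , ∣S₀∣) ,
  λ S S-decycling → ceil3-least (LowerBound.lower-bound S S-decycling 3≤m)
  where open CycleSquare m

theorem4 : (n : ℕ) → 4 ≤ n →
    (n % 3 ≢ 2 → IsDecyclingNumber (Power (Cycle n) 2) (ceil3 (n + 1)))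
    × (n % 3 ≡ 2 → IsDecyclingNumber (Power (Cycle n) 2) (ceil3 (n + 1) + 1))
theorem4 (suc m) (s≤s 3≤m) =
  (λ n%3≢2 → subst (IsDecyclingNumber C²) (proj₁ (ceil3-step (suc m)) n%3≢2) ∇) ,
  (λ n%3≡2 → subst (IsDecyclingNumber C²) (proj₂ (ceil3-step (suc m)) n%3≡2) ∇)
  where
  C² = Power (Cycle (suc m)) 2
  ∇ = decyclingNumber m 3≤m
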